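{- Let $T$ be a finite tree whose center consists of a single vertex. A set $S\subseteq V(T)$ is a determining set for $T$ if and only if for every vertex $v$ of $T$ and every isomorphism class of branches at $v$, the set $S$ contains a vertex different from $v$ from each of the branches in that class except (at most) one; that is, all but one of the branches in each isomorphism class of branches at $v$ contain a vertex of $S\setminus\{v\}$.
   Context: A set $S\subseteq V(G)$ of a graph $G$ is a determining set if whenever $g,h\in\mathrm{Aut}(G)$ satisfy $g(s)=h(s)$ for all $s\in S$, then $g=h$. For a vertex $v$ of a tree $T$, a branch at $v$ is the subgraph induced by $v$ together with the vertices of one connected component of $T-v$ (so a branch is a maximal subtree containing $v$ as a leaf). Two branches $H,K$ at $v$ are isomorphic if there is a graph isomorphism $H\to K$ mapping $v$ to $v$; this partitions the branches at $v$ into isomorphism classes. The center of a tree is the set of vertices of minimum eccentricity. -}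

module Defs where

open import Data.Nat using (ℕ; zero; suc; _≤_; _≥_)
open import Data.Fin using (Fin)
open import Data.Fin.Subset using (Subset; _∈_)
open import Data.List using (List; []; _∷_; length)
open import Data.List.Relation.Unary.Unique.Propositional using (Unique)
open import Data.Product using (Σ; ∃; ∃-syntax; _×_; _,_)
open import Data.Sum using (_⊎_)
open import Data.Unit using (⊤)
open import Data.Empty using (⊥)
open import Relation.Nullary using (¬_)
open import Relation.Binary.PropositionalEquality using (_≡_; _≢_)
open import Function.Bundles using (_⇔_)

record SimpleGraph (n : ℕ) : Set₁ where
  field
    Adj     : Fin n → Fin n → Set
    sym     : ∀ {x y} → Adj x y → Adj y x
    irrefl  : ∀ {x} → ¬ Adj x x
open SimpleGraph public

module _ {n : ℕ} (G : SimpleGraph n) where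

  data Walk : Fin n → Fin n → ℕ → Set where
    nil  : ∀ {u} → Walk u u zero
    cons : ∀ {u x w k} → Adj G u x → Walk x w k → Walk u w (suc k)

  data ReachIn (P : Fin n → Set) : Fin n → Fin n → Set where
    here : ∀ {u} → P u → ReachIn P u u
    step : ∀ {u x w} → P u → Adj G u x → ReachIn P x w → ReachIn P u w

  Connected : Set
  Connected = ∀ u w → ReachIn (λ _ → ⊤) u w

  data Path : List (Fin n) → Set where
    single : ∀ {x} → Path (x ∷ [])
    more   : ∀ {x y xs} → Adj G x y → Path (y ∷ xs) → Path (x ∷ y ∷ xs)

  IsCycle : Fin n → List (Fin n) → Fin n → Set
  IsCycle x₀ xs xk = Unique (x₀ ∷ xs) × Path (x₀ ∷ xs) × length xs ≥ 2 × LastIs (x₀ ∷ xs) xk × Adj G xk x₀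
    where
      LastIs : List (Fin n) → Fin n → Set
      LastIs [] _ = ⊥
      LastIs (y ∷ []) z = y ≡ z
      LastIs (_ ∷ y ∷ ys) z = LastIs (y ∷ ys) z

  Acyclic : Set
  Acyclic = ∀ x₀ xs xk → ¬ IsCycle x₀ xs xk

  IsTree : Set
  IsTree = (1 ≤ n) × Connected × Acyclic

  IsDist : Fin n → Fin n → ℕ → Set
  IsDist u w d = Walk u w d × (∀ k → Walk u w k → d ≤ k)

  IsEcc : Fin n → ℕ → Set
  IsEcc v e = (∀ w d → IsDist v w d → d ≤ e) × (∃[ w ] IsDist v w e)

  InCenter : Fin n → Set
  InCenter v = ∃[ e ] (IsEcc v e × (∀ y e′ → IsEcc y e′ → e ≤ e′))

  CenterIsSingleton : Set
  CenterIsSingleton = ∃[ c ] (∀ x → InCenter x ⇔ (x ≡ c))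

  record Aut : Set where
    field
      to      : Fin n → Fin n
      from    : Fin n → Fin n
      to-from : ∀ x → to (from x) ≡ x
      from-to : ∀ x → from (to x) ≡ x
      adj     : ∀ x y → Adj G x y ⇔ Adj G (to x) (to y)

  IsDeterminingSet : Subset n → Set
  IsDeterminingSet S = ∀ (g h : Aut) →
    (∀ s → s ∈ S → Aut.to g s ≡ Aut.to h s) → ∀ x → Aut.to g x ≡ Aut.to h x

  -- Branches at v correspond to neighbours u of v: the branch at v through u
  -- has vertex set {v} ∪ (component of T - v containing u).
  InBranch : Fin n → Fin n → Fin n → Set
  InBranch v u w = (w ≡ v) ⊎ ReachIn (λ x → x ≢ v) u w

  record BranchIso (v u₁ u₂ : Fin n) : Set where
    field
      to      : Fin n → Fin n
      from    : Fin n → Fin n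
      to-v    : to v ≡ v
      to-in   : ∀ x → InBranch v u₁ x → InBranch v u₂ (to x)
      from-in : ∀ y → InBranch v u₂ y → InBranch v u₁ (from y)
      from-to : ∀ x → InBranch v u₁ x → from (to x) ≡ x
      to-from : ∀ y → InBranch v u₂ y → to (from y) ≡ y
      adj     : ∀ x y → InBranch v u₁ x → InBranch v u₁ y →
                Adj G x y ⇔ Adj G (to x) (to y)

  Hits : Subset n → Fin n → Fin n → Set
  Hits S v u = ∃[ w ] (w ∈ S × w ≢ v × InBranch v u w)

  -- For every v and every isomorphism class of branches at v, all but at most
  -- one branch of the class contain a vertex of S ∖ {v}; equivalently, of any two
  -- distinct isomorphic branches at v, at least one is hit.
  BranchCondition : Subset n → Set
  BranchCondition S = ∀ v u₁ u₂ → Adj G v u₁ → Adj G v u₂ → u₁ ≢ u₂ →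
    BranchIso v u₁ u₂ → Hits S v u₁ ⊎ Hits S v u₂

module Submission where

-- In a tree, distinct branches at v meet only in v. If S meets all but one branch of
-- every class, let f fix S pointwise and suppose f moves some vertex. The centre c is
-- fixed, so some edge v–u on a path from c has f v = v and f u ≠ u; f then maps the
-- branch through u isomorphically onto the different branch through f u, one of them
-- contains a vertex of S, and that vertex, being fixed, lies in both — impossible.
-- Conversely, if two isomorphic branches at v both miss S, exchanging them by the
-- isomorphism and fixing everything else is a non-identity automorphism fixing S
-- pointwise, so S is not determining.

open import Defs
open import Data.Nat using (ℕ; s≤s; z≤n)
open import Data.Fin using (Fin)
open import Data.Fin.Properties using (_≟_; any?)
open import Data.Fin.Subset using (Subset; _∈_)
open import Data.Fin.Subset.Properties using (_∈?_)
open import Data.List using (List; []; _∷_)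
import Data.List.Membership.DecPropositional as DecMembership
open import Data.List.Relation.Unary.All as All using (All; []; _∷_)
open import Data.List.Relation.Unary.All.Properties.Core using (¬Any⇒All¬)
open import Data.List.Relation.Unary.Any using (here; there)
open import Data.List.Relation.Unary.AllPairs using ([]; _∷_)
open import Data.List.Relation.Unary.Unique.Propositional using (Unique)
open import Data.Product using (∃-syntax; _×_; _,_; proj₁; proj₂)
open import Data.Sum using (_⊎_; inj₁; inj₂; [_,_]′)
open import Data.Empty using (⊥; ⊥-elim)
open import Relation.Nullary using (¬_; Dec; yes; no)
open import Relation.Nullary.Decidable using (¬?; _×-dec_)
open import Relation.Unary using (Decidable)
open import Relation.Binary.PropositionalEquality as ≡ using (_≡_; _≢_; refl; trans; cong; subst; subst₂)
open import Function.Base using (_$_)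
open import Function.Bundles using (_⇔_; mk⇔; Equivalence)

-- IsCycle's LastIs is bound in a where block and cannot be named; its type is recovered
-- by unification with the fourth factor of the product.
fourth : {A B C D E : Set} → (A × B × C × D × E → A × B × C × D × E) → Set
fourth {D = D} _ = D

module _ {n : ℕ} (G : SimpleGraph n) where
  open DecMembership (_≟_ {n}) using () renaming (_∈_ to _∈ₗ_; _∈?_ to _∈ₗ?_)

  ReachIn-start : ∀ {P u w} → ReachIn G P u w → P u
  ReachIn-start (here p)     = p
  ReachIn-start (step p _ _) = p

  ReachIn-snoc : ∀ {P u x y} → ReachIn G P u x → Adj G x y → P y → ReachIn G P u y
  ReachIn-snoc (here p)     xy py = step p xy (here py)
  ReachIn-snoc (step p a r) xy py = step p a (ReachIn-snoc r xy py)

  ReachIn-++ : ∀ {P u x w} → ReachIn G P u x → ReachIn G P x w → ReachIn G P u w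
  ReachIn-++ (here _)     r′ = r′
  ReachIn-++ (step p a r) r′ = step p a (ReachIn-++ r r′)

  ReachIn-reverse : ∀ {P u w} → ReachIn G P u w → ReachIn G P w u
  ReachIn-reverse (here p)     = here p
  ReachIn-reverse (step p a r) = ReachIn-snoc (ReachIn-reverse r) (sym G a) p

  ReachIn-last-exit : ∀ {P v u w} → ReachIn G P u w → w ≢ v →
    ReachIn G (λ x → x ≢ v) u w ⊎ ∃[ y ] (Adj G v y × ReachIn G (λ x → x ≢ v) y w)
  ReachIn-last-exit (here _) w≢v = inj₁ (here w≢v)
  ReachIn-last-exit {v = v} {u = u} (step {x = x} _ ux r) w≢v with ReachIn-last-exit r w≢v
  ... | inj₂ exit = inj₂ exit
  ... | inj₁ r′ with u ≟ v
  ...   | yes refl = inj₂ (x , ux , r′)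
  ...   | no u≢v   = inj₁ (step u≢v ux r′)

  data Last : List (Fin n) → Fin n → Set where
    last-[] : ∀ {y} → Last (y ∷ []) y
    last-∷  : ∀ {x y ys z} → Last (y ∷ ys) z → Last (x ∷ y ∷ ys) z

  CycleLast : Fin n → List (Fin n) → Fin n → Set
  CycleLast x₀ xs xk = fourth (λ (c : IsCycle G x₀ xs xk) → c)

  -- The recursive call typechecks because LastIs does not depend on IsCycle's arguments.
  Last⇒CycleLast : ∀ x₀ xs xk → Last (x₀ ∷ xs) xk → CycleLast x₀ xs xk
  Last⇒CycleLast x₀ []       xk last-[]      = refl
  Last⇒CycleLast x₀ (y ∷ ys) xk (last-∷ lst) = Last⇒CycleLast y ys xk lst

  record SimplePath (P : Fin n → Set) (a b : Fin n) : Set where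
    constructor simplePath
    field
      rest   : List (Fin n)
      unique : Unique (a ∷ rest)
      path   : Path G (a ∷ rest)
      last   : Last (a ∷ rest) b
      inside : All P (a ∷ rest)

  SimplePath-suffix : ∀ {P a b u} (p : SimplePath P a b) → u ∈ₗ (a ∷ SimplePath.rest p) → SimplePath P u b
  SimplePath-suffix p (here refl) = p
  SimplePath-suffix (simplePath (_ ∷ ys) (_ ∷ un) (more _ pa) (last-∷ lst) (_ ∷ al)) (there u∈) =
    SimplePath-suffix (simplePath ys un pa lst al) u∈

  ReachIn⇒SimplePath : ∀ {P u w} → ReachIn G P u w → SimplePath P u w
  ReachIn⇒SimplePath (here p) = simplePath [] ([] ∷ []) single last-[] (p ∷ [])
  ReachIn⇒SimplePath {u = u} (step {x = x} p ux r) with ReachIn⇒SimplePath r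
  ... | q@(simplePath ys un pa lst al) with u ∈ₗ? (x ∷ ys)
  ...   | yes u∈ = SimplePath-suffix q u∈
  ...   | no u∉  = simplePath (x ∷ ys) (¬Any⇒All¬ (x ∷ ys) u∉ ∷ un) (more ux pa) (last-∷ lst) (p ∷ al)

  InOpenBranch : Fin n → Fin n → Fin n → Set
  InOpenBranch v u x = InBranch G v u x × x ≢ v

  neighbour-InOpenBranch : ∀ {v u} → Adj G v u → InOpenBranch v u u
  neighbour-InOpenBranch {v} {u} vu = inj₂ (here u≢v) , u≢v
    where
      u≢v : u ≢ v
      u≢v u≡v = irrefl G (subst (Adj G v) u≡v vu)

  ¬Hits⇒¬InOpenBranch : ∀ {S v u s} → ¬ Hits G S v u → s ∈ S → ¬ InOpenBranch v u s
  ¬Hits⇒¬InOpenBranch {s = s} miss s∈S (b , s≢v) = miss (s , s∈S , s≢v , b)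

  InOpenBranch-Adj : ∀ {v u x y} → InOpenBranch v u x → Adj G x y → InBranch G v u y
  InOpenBranch-Adj {v} {y = y} (b , x≢v) xy with y ≟ v | b
  ... | yes y≡v | _        = inj₁ y≡v
  ... | no  _   | inj₁ x≡v = ⊥-elim (x≢v x≡v)
  ... | no  y≢v | inj₂ r   = inj₂ (ReachIn-snoc r xy y≢v)

  module _ (acyclic : Acyclic G) where

    neighbours-unlinked : ∀ {v a b} → Adj G v a → Adj G v b → a ≢ b → ¬ ReachIn G (λ x → x ≢ v) a b
    neighbours-unlinked {v} {a} {b} va vb a≢b r with ReachIn⇒SimplePath r
    ... | simplePath []       _  _  last-[] _  = a≢b refl
    ... | simplePath (y ∷ ys) un pa lst     al = acyclic v (a ∷ y ∷ ys) b
      ( All.map (λ x≢v v≡x → x≢v (≡.sym v≡x)) al ∷ un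
      , more va pa
      , s≤s (s≤s z≤n)
      , Last⇒CycleLast v (a ∷ y ∷ ys) b (last-∷ lst)
      , sym G vb )

    open-branches-disjoint : ∀ {v u₁ u₂ x} → Adj G v u₁ → Adj G v u₂ → u₁ ≢ u₂ →
      InOpenBranch v u₁ x → ¬ InOpenBranch v u₂ x
    open-branches-disjoint _   _   _     (inj₁ x≡v , x≢v) _              = x≢v x≡v
    open-branches-disjoint _   _   _     (inj₂ _   , _)   (inj₁ x≡v , x≢v) = x≢v x≡v
    open-branches-disjoint vu₁ vu₂ u₁≢u₂ (inj₂ r₁  , _)   (inj₂ r₂  , _) =
      neighbours-unlinked vu₁ vu₂ u₁≢u₂ (ReachIn-++ r₁ (ReachIn-reverse r₂))

    module _ (connected : Connected G) where

      InBranch? : ∀ {v u} → Adj G v u → Decidable (InBranch G v u)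
      InBranch? {v} {u} vu w with w ≟ v
      ... | yes w≡v = yes (inj₁ w≡v)
      ... | no  w≢v with ReachIn-last-exit {v = v} (connected v w) w≢v
      ...   | inj₁ r = ⊥-elim (ReachIn-start r refl)
      ...   | inj₂ (y , vy , r) with y ≟ u
      ...     | yes refl = yes (inj₂ r)
      ...     | no  y≢u  = no λ b → open-branches-disjoint vy vu y≢u (inj₂ r , w≢v) (b , w≢v)

      InOpenBranch? : ∀ {v u} → Adj G v u → Decidable (InOpenBranch v u)
      InOpenBranch? {v} vu x = InBranch? vu x ×-dec ¬? (x ≟ v)

      Hits? : ∀ S {v u} → Adj G v u → Dec (Hits G S v u)
      Hits? S {v} vu = any? λ w → (w ∈? S) ×-dec (¬? (w ≟ v) ×-dec InBranch? vu w)

module _ {n : ℕ} {G : SimpleGraph n} where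

  BranchIso-sym : ∀ {v u₁ u₂} → BranchIso G v u₁ u₂ → BranchIso G v u₂ u₁
  BranchIso-sym {v} φ = record
    { to      = from
    ; from    = to
    ; to-v    = trans (cong from (≡.sym to-v)) (from-to v (inj₁ refl))
    ; to-in   = from-in
    ; from-in = to-in
    ; from-to = to-from
    ; to-from = from-to
    ; adj     = λ x y bx by → mk⇔
        (λ xy → Equivalence.from (adj (from x) (from y) (from-in x bx) (from-in y by))
                  (subst₂ (Adj G) (≡.sym (to-from x bx)) (≡.sym (to-from y by)) xy))
        (λ xy → subst₂ (Adj G) (to-from x bx) (to-from y by)
                  (Equivalence.to (adj (from x) (from y) (from-in x bx) (from-in y by)) xy))
    }
    where open BranchIso φ

  FixesPointwise : Subset n → Aut G → Set
  FixesPointwise S f = ∀ s → s ∈ S → Aut.to f s ≡ s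

  Aut-id : Aut G
  Aut-id = record
    { to = λ x → x ; from = λ x → x ; to-from = λ _ → refl ; from-to = λ _ → refl
    ; adj = λ _ _ → mk⇔ (λ xy → xy) (λ xy → xy) }

  Aut-inv : Aut G → Aut G
  Aut-inv f = record
    { to = from ; from = to ; to-from = from-to ; from-to = to-from
    ; adj = λ x y → mk⇔
        (λ xy → Equivalence.from (adj (from x) (from y))
                  (subst₂ (Adj G) (≡.sym (to-from x)) (≡.sym (to-from y)) xy))
        (λ xy → subst₂ (Adj G) (to-from x) (to-from y) (Equivalence.to (adj (from x) (from y)) xy))
    }
    where open Aut f

  Aut-∘ : Aut G → Aut G → Aut G
  Aut-∘ f g = record
    { to      = λ x → Aut.to f (Aut.to g x)
    ; from    = λ x → Aut.from g (Aut.from f x)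
    ; to-from = λ x → trans (cong (Aut.to f) (Aut.to-from g (Aut.from f x))) (Aut.to-from f x)
    ; from-to = λ x → trans (cong (Aut.from g) (Aut.from-to f (Aut.to g x))) (Aut.from-to g x)
    ; adj     = λ x y → mk⇔
        (λ xy → Equivalence.to (Aut.adj f _ _) (Equivalence.to (Aut.adj g x y) xy))
        (λ xy → Equivalence.from (Aut.adj g x y) (Equivalence.from (Aut.adj f _ _) xy))
    }

  module _ (f : Aut G) where
    open Aut f

    Aut-Adj : ∀ {x y} → Adj G x y → Adj G (to x) (to y)
    Aut-Adj {x} {y} = Equivalence.to (adj x y)

    Aut-injective : ∀ {x y} → to x ≡ to y → x ≡ y
    Aut-injective {x} {y} e = trans (≡.sym (from-to x)) (trans (cong from e) (from-to y))

    Aut-from-fixed : ∀ {v} → to v ≡ v → from v ≡ v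
    Aut-from-fixed {v} fv = trans (cong from (≡.sym fv)) (from-to v)

    Aut-Walk : ∀ {u w k} → Walk G u w k → Walk G (to u) (to w) k
    Aut-Walk nil         = nil
    Aut-Walk (cons a ws) = cons (Aut-Adj a) (Aut-Walk ws)

    Aut-ReachIn : ∀ {P Q : Fin n → Set} → (∀ {x} → P x → Q (to x)) →
      ∀ {u w} → ReachIn G P u w → ReachIn G Q (to u) (to w)
    Aut-ReachIn P⇒Q (here p)     = here (P⇒Q p)
    Aut-ReachIn P⇒Q (step p a r) = step (P⇒Q p) (Aut-Adj a) (Aut-ReachIn P⇒Q r)

    Aut-InBranch : ∀ {v u x} → to v ≡ v → InBranch G v u x → InBranch G v (to u) (to x)
    Aut-InBranch fv (inj₁ refl) = inj₁ fv
    Aut-InBranch fv (inj₂ r)    =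
      inj₂ (Aut-ReachIn (λ x≢v fx≡v → x≢v (Aut-injective (trans fx≡v (≡.sym fv)))) r)

  Aut-BranchIso : (f : Aut G) → ∀ {v u} → Aut.to f v ≡ v → BranchIso G v u (Aut.to f u)
  Aut-BranchIso f {v} {u} fv = record
    { to      = to
    ; from    = from
    ; to-v    = fv
    ; to-in   = λ _ → Aut-InBranch f fv
    ; from-in = λ y b → subst (λ a → InBranch G v a (from y)) (from-to u)
                          (Aut-InBranch (Aut-inv f) (Aut-from-fixed f fv) b)
    ; from-to = λ x _ → from-to x
    ; to-from = λ y _ → to-from y
    ; adj     = λ x y _ _ → adj x y
    }
    where open Aut f

  Aut-IsDist : (f : Aut G) → ∀ {u w d} → IsDist G u w d → IsDist G (Aut.to f u) (Aut.to f w) d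
  Aut-IsDist f {u} {w} (walk , shortest) = Aut-Walk f walk , λ k walk′ →
    shortest k (subst₂ (λ a b → Walk G a b k) (Aut.from-to f u) (Aut.from-to f w)
                  (Aut-Walk (Aut-inv f) walk′))

  Aut-IsEcc : (f : Aut G) → ∀ {v e} → IsEcc G v e → IsEcc G (Aut.to f v) e
  Aut-IsEcc f {v} (bounded , w , attained) =
    (λ w′ d dist → bounded (Aut.from f w′) d
       (subst (λ a → IsDist G a (Aut.from f w′) d) (Aut.from-to f v) (Aut-IsDist (Aut-inv f) dist)))
    , Aut.to f w , Aut-IsDist f attained

  Aut-InCenter : (f : Aut G) → ∀ {v} → InCenter G v → InCenter G (Aut.to f v)
  Aut-InCenter f (e , ecc , minimal) = e , Aut-IsEcc f ecc , minimal

  Aut-fixes-center : ((c , _) : CenterIsSingleton G) → (f : Aut G) → Aut.to f c ≡ c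
  Aut-fixes-center (c , center≡c) f =
    Equivalence.to (center≡c _) (Aut-InCenter f (Equivalence.from (center≡c c) refl))

  crossing-edge : ∀ {P Q : Fin n → Set} → Decidable P → ∀ {u x} → ReachIn G Q u x → P u → ¬ P x →
    ∃[ v ] ∃[ w ] (P v × Adj G v w × ¬ P w)
  crossing-edge P? (here _) pu ¬px = ⊥-elim (¬px pu)
  crossing-edge P? {u} (step {x = y} _ uy r) pu ¬px with P? y
  ... | yes py = crossing-edge P? r py ¬px
  ... | no ¬py = u , y , pu , uy , ¬py

  identity-only-fixer⇒determining : ∀ S →
    (∀ f → FixesPointwise S f → ∀ x → Aut.to f x ≡ x) → IsDeterminingSet G S
  identity-only-fixer⇒determining S only-id g h g≗h x = begin
    Aut.to g x                         ≡⟨ Aut.to-from h _ ⟨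
    Aut.to h (Aut.from h (Aut.to g x)) ≡⟨ cong (Aut.to h) (only-id (Aut-∘ (Aut-inv h) g) h⁻¹g-fixes x) ⟩
    Aut.to h x                         ∎
    where
      open ≡.≡-Reasoning
      h⁻¹g-fixes : FixesPointwise S (Aut-∘ (Aut-inv h) g)
      h⁻¹g-fixes s s∈S = trans (cong (Aut.from h) (g≗h s s∈S)) (Aut.from-to h s)

module _ {n : ℕ} {G : SimpleGraph n} (acyclic : Acyclic G) (connected : Connected G) where

  branch-condition⇒only-identity-fixes : CenterIsSingleton G → ∀ S → BranchCondition G S →
    ∀ f → FixesPointwise S f → ∀ x → Aut.to f x ≡ x
  branch-condition⇒only-identity-fixes center S condition f fixes-S x with Aut.to f x ≟ x
  ... | yes fx≡x = fx≡x
  ... | no  fx≢x with crossing-edge (λ y → Aut.to f y ≟ y)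
                        (connected (proj₁ center) x) (Aut-fixes-center center f) fx≢x
  ...   | v , u , fv≡v , vu , fu≢u = ⊥-elim $
    [ hit-both , (λ (w , w∈S , w≢v , bw) → hit-both (w , w∈S , w≢v , hit-back w∈S bw)) ]′
      (condition v u (Aut.to f u) vu v-fu u≢fu (Aut-BranchIso f fv≡v))
    where
      v-fu : Adj G v (Aut.to f u)
      v-fu = subst (λ a → Adj G a (Aut.to f u)) fv≡v (Aut-Adj f vu)
      u≢fu : u ≢ Aut.to f u
      u≢fu e = fu≢u (≡.sym e)
      hit-back : ∀ {w} → w ∈ S → InBranch G v (Aut.to f u) w → InBranch G v u w
      hit-back {w} w∈S b = subst₂ (InBranch G v) (Aut.from-to f u) (Aut-from-fixed f (fixes-S w w∈S))
        (Aut-InBranch (Aut-inv f) (Aut-from-fixed f fv≡v) b)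
      hit-both : Hits G S v u → ⊥
      hit-both (w , w∈S , w≢v , bw) = open-branches-disjoint G acyclic vu v-fu u≢fu (bw , w≢v)
        (subst (InBranch G v (Aut.to f u)) (fixes-S w w∈S) (Aut-InBranch f fv≡v bw) , w≢v)

  module Swap {v u₁ u₂ : Fin n} (vu₁ : Adj G v u₁) (vu₂ : Adj G v u₂) (u₁≢u₂ : u₁ ≢ u₂)
              (φ : BranchIso G v u₁ u₂) where

    ψ : BranchIso G v u₂ u₁
    ψ = BranchIso-sym φ

    Outside : Fin n → Set
    Outside x = ¬ InOpenBranch G v u₁ x × ¬ InOpenBranch G v u₂ x

    data Region (x : Fin n) : Set where
      first   : InOpenBranch G v u₁ x → Region x
      second  : InOpenBranch G v u₂ x → Region x
      outside : Outside x → Region x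

    region : ∀ x → Region x
    region x with InOpenBranch? G acyclic connected vu₁ x | InOpenBranch? G acyclic connected vu₂ x
    ... | yes o₁ | _      = first o₁
    ... | no  _  | yes o₂ = second o₂
    ... | no ¬o₁ | no ¬o₂ = outside (¬o₁ , ¬o₂)

    disjoint : ∀ {x} → InOpenBranch G v u₁ x → ¬ InOpenBranch G v u₂ x
    disjoint = open-branches-disjoint G acyclic vu₁ vu₂ u₁≢u₂

    σ : Fin n → Fin n
    σ x with region x
    ... | first _   = BranchIso.to φ x
    ... | second _  = BranchIso.to ψ x
    ... | outside _ = x

    σ-outside : ∀ {x} → Outside x → σ x ≡ x
    σ-outside {x} (¬o₁ , ¬o₂) with region x
    ... | first o₁  = ⊥-elim (¬o₁ o₁)
    ... | second o₂ = ⊥-elim (¬o₂ o₂)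
    ... | outside _ = refl

    σ-on-first : ∀ {x} → InBranch G v u₁ x → σ x ≡ BranchIso.to φ x
    σ-on-first {x} b with region x
    ... | first _   = refl
    ... | second o₂ = ⊥-elim (disjoint (b , proj₂ o₂) o₂)
    ... | outside (¬o₁ , _) with x ≟ v
    ...   | yes refl = ≡.sym (BranchIso.to-v φ)
    ...   | no  x≢v  = ⊥-elim (¬o₁ (b , x≢v))

    σ-on-second : ∀ {x} → InBranch G v u₂ x → σ x ≡ BranchIso.to ψ x
    σ-on-second {x} b with region x
    ... | first o₁  = ⊥-elim (disjoint o₁ (b , proj₂ o₁))
    ... | second _  = refl
    ... | outside (_ , ¬o₂) with x ≟ v
    ...   | yes refl = ≡.sym (BranchIso.to-v ψ)
    ...   | no  x≢v  = ⊥-elim (¬o₂ (b , x≢v))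

    σ-involutive : ∀ x → σ (σ x) ≡ x
    σ-involutive x = by-region (region x)
      where
        by-region : Region x → σ (σ x) ≡ x
        by-region (first (b , _))  = trans (cong σ (σ-on-first b))
          (trans (σ-on-second (BranchIso.to-in φ x b)) (BranchIso.from-to φ x b))
        by-region (second (b , _)) = trans (cong σ (σ-on-second b))
          (trans (σ-on-first (BranchIso.to-in ψ x b)) (BranchIso.from-to ψ x b))
        by-region (outside o)      = trans (cong σ (σ-outside o)) (σ-outside o)

    -- Every edge lies inside one of the three closed regions on which σ is a single map.
    edge-region : ∀ {x y} → Adj G x y →
      (InBranch G v u₁ x × InBranch G v u₁ y) ⊎ (InBranch G v u₂ x × InBranch G v u₂ y) ⊎ (Outside x × Outside y)
    edge-region {x} {y} xy with region x | region y
    ... | first o₁   | _          = inj₁ (proj₁ o₁ , InOpenBranch-Adj G o₁ xy)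
    ... | second o₂  | _          = inj₂ (inj₁ (proj₁ o₂ , InOpenBranch-Adj G o₂ xy))
    ... | outside _  | first o₁   = inj₁ (InOpenBranch-Adj G o₁ (sym G xy) , proj₁ o₁)
    ... | outside _  | second o₂  = inj₂ (inj₁ (InOpenBranch-Adj G o₂ (sym G xy) , proj₁ o₂))
    ... | outside ox | outside oy = inj₂ (inj₂ (ox , oy))

    σ-Adj : ∀ {x y} → Adj G x y → Adj G (σ x) (σ y)
    σ-Adj {x} {y} xy with edge-region xy
    ... | inj₁ (bx , by) = subst₂ (Adj G) (≡.sym (σ-on-first bx)) (≡.sym (σ-on-first by))
                             (Equivalence.to (BranchIso.adj φ x y bx by) xy)
    ... | inj₂ (inj₁ (bx , by)) = subst₂ (Adj G) (≡.sym (σ-on-second bx)) (≡.sym (σ-on-second by))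
                                    (Equivalence.to (BranchIso.adj ψ x y bx by) xy)
    ... | inj₂ (inj₂ (ox , oy)) = subst₂ (Adj G) (≡.sym (σ-outside ox)) (≡.sym (σ-outside oy)) xy

    swap : Aut G
    swap = record
      { to = σ ; from = σ ; to-from = σ-involutive ; from-to = σ-involutive
      ; adj = λ x y → mk⇔ σ-Adj (λ σxy → subst₂ (Adj G) (σ-involutive x) (σ-involutive y) (σ-Adj σxy)) }

    swap-moves-u₁ : σ u₁ ≢ u₁
    swap-moves-u₁ σu₁≡u₁ = disjoint u₁-open (u₁-in-second , proj₂ u₁-open)
      where
        u₁-open : InOpenBranch G v u₁ u₁
        u₁-open = neighbour-InOpenBranch G vu₁
        u₁-in-second : InBranch G v u₂ u₁
        u₁-in-second = subst (InBranch G v u₂) (trans (≡.sym (σ-on-first (proj₁ u₁-open))) σu₁≡u₁)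
          (BranchIso.to-in φ u₁ (proj₁ u₁-open))

  determining⇒branch-condition : ∀ S → IsDeterminingSet G S → BranchCondition G S
  determining⇒branch-condition S determining v u₁ u₂ vu₁ vu₂ u₁≢u₂ φ
    with Hits? G acyclic connected S vu₁ | Hits? G acyclic connected S vu₂
  ... | yes hit₁ | _        = inj₁ hit₁
  ... | no  _    | yes hit₂ = inj₂ hit₂
  ... | no  miss₁ | no miss₂ = ⊥-elim (swap-moves-u₁ (determining swap Aut-id swap-fixes-S u₁))
    where
      open Swap vu₁ vu₂ u₁≢u₂ φ
      swap-fixes-S : FixesPointwise S swap
      swap-fixes-S s s∈S = σ-outside (¬Hits⇒¬InOpenBranch G miss₁ s∈S , ¬Hits⇒¬InOpenBranch G miss₂ s∈S)

theorem11 : ∀ {n : ℕ} (T : SimpleGraph n) → IsTree T → CenterIsSingleton T →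
    ∀ (S : Subset n) → IsDeterminingSet T S ⇔ BranchCondition T S
theorem11 T (_ , connected , acyclic) center S = mk⇔
  (determining⇒branch-condition acyclic connected S)
  (λ condition → identity-only-fixer⇒determining S
     (branch-condition⇒only-identity-fixes acyclic connected center S condition))
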